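{- Let $G$ be a simple connected graph on $[n]$ such that its Laplacian simplex $\mathcal{P}_G$ is reflexive. Then the map $f:\Lambda(\mathcal{P}_G)\to\Lambda(\mathcal{P}_G)$, $\lambda\mapsto\frac{n-1}{n}\mathbb{1}-\lambda$, is a well-defined bijection, and $\mathrm{ht}(\lambda)=i$ if and only if $\mathrm{ht}(f(\lambda))=n-1-i$. Consequently, for each $0\le i\le n-1$ the restriction of $f$ is a bijection from $\{\lambda\in\Lambda(\mathcal{P}_G)\mid\mathrm{ht}(\lambda)=i\}$ onto $\{\lambda\in\Lambda(\mathcal{P}_G)\mid\mathrm{ht}(\lambda)=n-1-i\}$.
   Context: The Laplacian matrix $L$ of a simple graph on $[n]$ has $L_{ii}=\deg(i)$, $L_{ij}=-1$ if $\{i,j\}$ is an edge and $0$ otherwise; the Laplacian simplex $\mathcal{P}_G$ is the convex hull in $\mathbb{R}^{n-1}$ of the rows $\mathbf{v}_1,\dots,\mathbf{v}_n$ (in order) of $L$ with its $n$-th column deleted. A lattice polytope is reflexive if it contains the origin in its interior and its dual is a lattice polytope. $\Lambda(\mathcal{P}_G)$ is the set of $\lambda\in[0,1)^n$ with $\sum_i\lambda_i(\mathbf{v}_i,1)\in\mathbb{Z}^n$, and the height of $\lambda$ is $\mathrm{ht}(\lambda)=\sum_i\lambda_i$.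
   Formalization: The vectors λ in $\Lambda(\mathcal{P}_G)$ have rational entries, and reflexivity is stated with the interior, the dual and convex hulls taken over points with rational coordinates and rational convex coefficients. -}

module Defs where

open import Data.Nat as ℕ using (ℕ; zero; suc)
open import Data.Integer as ℤ using (ℤ; +_; -[1+_])
open import Data.Rational as ℚ using (ℚ; 0ℚ; 1ℚ; _/_; _+_; _*_; _-_; _≤_; _<_; ∣_∣; -_)
open import Data.Fin using (Fin; inject₁; _≟_)
open import Data.Bool using (Bool; true; false; if_then_else_)
open import Data.Vec.Functional using (foldr)
open import Data.Product using (Σ; ∃; _×_)
open import Relation.Nullary.Decidable using (⌊_⌋)
open import Relation.Binary.PropositionalEquality using (_≡_)
open import Relation.Binary.Construct.Closure.ReflexiveTransitive using (Star)
open import Function.Bundles using (_⇔_)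

record SimpleGraph (n : ℕ) : Set where
  field
    adj    : Fin n → Fin n → Bool
    sym    : ∀ i j → adj i j ≡ adj j i
    irrefl : ∀ i → adj i i ≡ false
open SimpleGraph public

Connected : ∀ {n} → SimpleGraph n → Set
Connected G = ∀ i j → Star (λ a b → adj G a b ≡ true) i j

deg : ∀ {n} → SimpleGraph n → Fin n → ℕ
deg G i = foldr (λ b acc → if b then suc acc else acc) 0 (adj G i)

laplacian : ∀ {n} → SimpleGraph n → Fin n → Fin n → ℤ
laplacian G i j =
  if ⌊ i ≟ j ⌋ then + deg G i else (if adj G i j then -[1+ 0 ] else + 0)

Point : ℕ → Set
Point d = Fin d → ℚ

fromℤ : ℤ → ℚ
fromℤ z = z / 1

sumℚ : ∀ {n} → (Fin n → ℚ) → ℚ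
sumℚ f = foldr _+_ 0ℚ f

dot : ∀ {d} → Point d → Point d → ℚ
dot x y = sumℚ (λ k → x k * y k)

-- vertices v_1..v_n of the Laplacian simplex of G on [m+1]:
-- rows of L with the last column deleted, living in ℚ^m
lapVert : ∀ {m} → SimpleGraph (suc m) → Fin (suc m) → Point m
lapVert G i k = fromℤ (laplacian G i (inject₁ k))

InConvHull : ∀ {n d} → (Fin n → Point d) → Point d → Set
InConvHull {n} vs x =
  Σ (Fin n → ℚ) λ c → (∀ i → 0ℚ ≤ c i) × (sumℚ c ≡ 1ℚ)
    × (∀ k → sumℚ (λ i → c i * vs i k) ≡ x k)

OriginInInterior : ∀ {d} → (Point d → Set) → Set
OriginInInterior {d} P =
  Σ ℚ λ ε → (0ℚ < ε) × (∀ (x : Point d) → (∀ k → ∣ x k ∣ < ε) → P x)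

Dual : ∀ {d} → (Point d → Set) → Point d → Set
Dual P y = ∀ x → P x → - 1ℚ ≤ dot x y

IsLatticePolytope : ∀ {d} → (Point d → Set) → Set
IsLatticePolytope {d} Q =
  Σ ℕ λ k → Σ (Fin k → Fin d → ℤ) λ ws →
    ∀ y → Q y ⇔ InConvHull (λ j l → fromℤ (ws j l)) y

IsReflexive : ∀ {n d} → (Fin n → Point d) → Set
IsReflexive vs =
  OriginInInterior (InConvHull vs) × IsLatticePolytope (Dual (InConvHull vs))

IsInt : ℚ → Set
IsInt q = ∃ λ (z : ℤ) → q ≡ fromℤ z

-- Λ(P_G): λ ∈ [0,1)^n with ∑ λ_i (v_i , 1) ∈ ℤ^n
InΛ : ∀ {m} → SimpleGraph (suc m) → (Fin (suc m) → ℚ) → Set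
InΛ {m} G l =
  (∀ i → (0ℚ ≤ l i) × (l i < 1ℚ))
  × (∀ (k : Fin m) → IsInt (sumℚ (λ i → l i * lapVert G i k)))
  × IsInt (sumℚ l)

ht : ∀ {n} → (Fin n → ℚ) → ℚ
ht = sumℚ

fΛ : ∀ {m} → (Fin (suc m) → ℚ) → Fin (suc m) → ℚ
fΛ {m} l i = (+ m / suc m) - l i

-- Since f is an affine involution lowering heights to (n−1) − ht, everything reduces to f mapping Λ
-- into Λ. The integrality conditions survive because the vertices vᵢ sum to zero (the columns of L
-- do), so the whole content is the bound λⱼ ≤ (n−1)/n. As the origin is interior, every zero-sum
-- vector is the vector of values ⟨vᵢ , y⟩ of some functional y; taking the values −1 off j and n−1
-- at j puts y in the dual polytope. There y is a convex combination of lattice points, and one with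
-- positive weight, Z, must also take the value −1 at every vᵢ with i ≠ j. Then ⟨vᵢ , Z⟩ + 1 is
-- n·δᵢⱼ, so n·λⱼ = ⟨∑ λᵢ vᵢ , Z⟩ + ht λ is an integer, which together with λⱼ < 1 gives the bound.

module Submission where

module LaplacianSimplex where

  open import Algebra.Bundles using (Ring)
  open import Data.Bool using (Bool; true; false; if_then_else_)
  open import Data.Empty using (⊥-elim)
  open import Data.Fin using (Fin; zero; suc; inject₁; fromℕ; punchIn; _≟_)
  open import Data.Fin.Properties using (punchInᵢ≢i)
  open import Data.Fin.Relation.Unary.Top using (view; ‵fromℕ; ‵inject₁)
  open import Data.Integer as ℤ using (ℤ; +_; -[1+_]; +≤+; +<+)
  import Data.Integer.Properties as ℤP
  open import Data.Nat as ℕ using (ℕ; zero; suc; s≤s; z≤n)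
  import Data.Nat.Properties as ℕP
  open import Data.Product using (Σ; _,_; proj₁; proj₂)
  open import Data.Rational as ℚ
    using (ℚ; 0ℚ; 1ℚ; _/_; _+_; _*_; -_; 1/_; ∣_∣; _≤_; _<_; toℚᵘ)
  import Data.Rational.Properties as ℚP
  open import Data.Rational.Solver using (module +-*-Solver)
  import Data.Rational.Unnormalised as ℚᵘ
  import Data.Rational.Unnormalised.Properties as ℚᵘP
  open import Data.Vec.Functional using (foldr; init)
  open import Function.Base using (_∘_)
  open import Function.Bundles using (_⇔_; mk⇔; Equivalence)
  open import Relation.Nullary using (yes; no)
  open import Relation.Nullary.Decidable using (⌊_⌋)
  open import Relation.Binary.PropositionalEquality

  open import Algebra.Properties.Group ℚP.+-0-group using ()
    renaming (∙-cancelˡ to +-cancelˡ; x∙y⁻¹≈ε⇒x≈y to x-y≡0⇒x≡y)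
  open import Algebra.Properties.Semiring.Sum (Ring.semiring ℚP.+-*-ring)
    using ( sum-cong-≗; sum-replicate-zero; sum-init-last; sum-remove
          ; ∑-distrib-+; ∑-comm; *-distribˡ-sum; *-distribʳ-sum)

  open import Defs hiding (sym)
  open +-*-Solver using (solve; _:+_; _:*_; :-_; _:=_; con)

  -- Integers inside ℚ

  toℚᵘ-fromℤ : ∀ z → toℚᵘ (fromℤ z) ℚᵘ.≃ ℚᵘ.mkℚᵘ z 0
  toℚᵘ-fromℤ z = ℚP.toℚᵘ-fromℚᵘ (ℚᵘ.mkℚᵘ z 0)

  fromℤ-+ : ∀ a b → fromℤ (a ℤ.+ b) ≡ fromℤ a + fromℤ b
  fromℤ-+ a b = ℚP.toℚᵘ-injective (begin
    toℚᵘ (fromℤ (a ℤ.+ b))              ≈⟨ toℚᵘ-fromℤ (a ℤ.+ b) ⟩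
    ℚᵘ.mkℚᵘ (a ℤ.+ b) 0                 ≈⟨ ℚᵘP.≃-reflexive (cong₂ (λ x y → ℚᵘ.mkℚᵘ (x ℤ.+ y) 0)
                                             (sym (ℤP.*-identityʳ a)) (sym (ℤP.*-identityʳ b))) ⟩
    ℚᵘ.mkℚᵘ a 0 ℚᵘ.+ ℚᵘ.mkℚᵘ b 0        ≈⟨ ℚᵘP.+-cong (toℚᵘ-fromℤ a) (toℚᵘ-fromℤ b) ⟨
    toℚᵘ (fromℤ a) ℚᵘ.+ toℚᵘ (fromℤ b)  ≈⟨ ℚP.toℚᵘ-homo-+ (fromℤ a) (fromℤ b) ⟨
    toℚᵘ (fromℤ a + fromℤ b)            ∎)
    where open ℚᵘP.≃-Reasoning

  fromℤ-* : ∀ a b → fromℤ (a ℤ.* b) ≡ fromℤ a * fromℤ b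
  fromℤ-* a b = ℚP.toℚᵘ-injective (begin
    toℚᵘ (fromℤ (a ℤ.* b))              ≈⟨ toℚᵘ-fromℤ (a ℤ.* b) ⟩
    ℚᵘ.mkℚᵘ a 0 ℚᵘ.* ℚᵘ.mkℚᵘ b 0        ≈⟨ ℚᵘP.*-cong (toℚᵘ-fromℤ a) (toℚᵘ-fromℤ b) ⟨
    toℚᵘ (fromℤ a) ℚᵘ.* toℚᵘ (fromℤ b)  ≈⟨ ℚP.toℚᵘ-homo-* (fromℤ a) (fromℤ b) ⟨
    toℚᵘ (fromℤ a * fromℤ b)            ∎)
    where open ℚᵘP.≃-Reasoning

  fromℤ-neg : ∀ z → fromℤ (ℤ.- z) ≡ - fromℤ z
  fromℤ-neg z = ℚP.toℚᵘ-injective (begin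
    toℚᵘ (fromℤ (ℤ.- z))    ≈⟨ toℚᵘ-fromℤ (ℤ.- z) ⟩
    ℚᵘ.- ℚᵘ.mkℚᵘ z 0        ≈⟨ ℚᵘP.-‿cong (toℚᵘ-fromℤ z) ⟨
    ℚᵘ.- toℚᵘ (fromℤ z)     ≈⟨ ℚP.toℚᵘ-homo‿- (fromℤ z) ⟨
    toℚᵘ (- fromℤ z)        ∎)
    where open ℚᵘP.≃-Reasoning

  fromℤ-mono-≤ : ∀ {a b} → a ℤ.≤ b → fromℤ a ≤ fromℤ b
  fromℤ-mono-≤ {a} {b} a≤b = ℚP.toℚᵘ-cancel-≤
    (ℚᵘP.≤-respˡ-≃ (ℚᵘP.≃-sym (toℚᵘ-fromℤ a)) (ℚᵘP.≤-respʳ-≃ (ℚᵘP.≃-sym (toℚᵘ-fromℤ b))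
      (ℚᵘ.*≤* (ℤP.*-monoʳ-≤-nonNeg (+ 1) a≤b))))

  fromℤ-cancel-< : ∀ {a b} → fromℤ a < fromℤ b → a ℤ.< b
  fromℤ-cancel-< {a} {b} a<b
    with ℚᵘP.<-respˡ-≃ (toℚᵘ-fromℤ a) (ℚᵘP.<-respʳ-≃ (toℚᵘ-fromℤ b) (ℚP.toℚᵘ-mono-< a<b))
  ... | ℚᵘ.*<* a*1<b*1 = subst₂ ℤ._<_ (ℤP.*-identityʳ a) (ℤP.*-identityʳ b) a*1<b*1

  fromℤ-mono-< : ∀ {a b} → a ℤ.< b → fromℤ a < fromℤ b
  fromℤ-mono-< {a} {b} a<b = ℚP.toℚᵘ-cancel-<
    (ℚᵘP.<-respˡ-≃ (ℚᵘP.≃-sym (toℚᵘ-fromℤ a)) (ℚᵘP.<-respʳ-≃ (ℚᵘP.≃-sym (toℚᵘ-fromℤ b))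
      (ℚᵘ.*<* (subst₂ ℤ._<_ (sym (ℤP.*-identityʳ a)) (sym (ℤP.*-identityʳ b)) a<b))))

  fromℤ-+[1+n]-pos : ∀ n → ℚ.Positive (fromℤ (+ suc n))
  fromℤ-+[1+n]-pos n = ℚP.normalize-pos (suc n) 1

  z/n*n≡z : ∀ z n → (z / suc n) * fromℤ (+ suc n) ≡ fromℤ z
  z/n*n≡z z n = ℚP.toℚᵘ-injective (begin
    toℚᵘ ((z / suc n) * fromℤ (+ suc n))               ≈⟨ ℚP.toℚᵘ-homo-* (z / suc n) (fromℤ (+ suc n)) ⟩
    toℚᵘ (z / suc n) ℚᵘ.* toℚᵘ (fromℤ (+ suc n))       ≈⟨ ℚᵘP.*-cong (ℚP.toℚᵘ-fromℚᵘ (ℚᵘ.mkℚᵘ z n))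
                                                                      (toℚᵘ-fromℤ (+ suc n)) ⟩
    ℚᵘ.mkℚᵘ z n ℚᵘ.* ℚᵘ.mkℚᵘ (+ suc n) 0               ≈⟨ ℚᵘ.*≡* (trans (ℤP.*-identityʳ _)
                                                             (cong (λ k → z ℤ.* + k) (sym (ℕP.*-identityʳ (suc n))))) ⟩
    ℚᵘ.mkℚᵘ z 0                                        ≈⟨ toℚᵘ-fromℤ z ⟨
    toℚᵘ (fromℤ z)                                     ∎)
    where open ℚᵘP.≃-Reasoning

  isInt-+ : ∀ {p q} → IsInt p → IsInt q → IsInt (p + q)
  isInt-+ (a , refl) (b , refl) = a ℤ.+ b , sym (fromℤ-+ a b)

  isInt-* : ∀ {p q} → IsInt p → IsInt q → IsInt (p * q)
  isInt-* (a , refl) (b , refl) = a ℤ.* b , sym (fromℤ-* a b)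

  isInt-neg : ∀ {p} → IsInt p → IsInt (- p)
  isInt-neg (a , refl) = ℤ.- a , sym (fromℤ-neg a)

  isInt-sum : ∀ {n} (f : Fin n → ℚ) → (∀ i → IsInt (f i)) → IsInt (sumℚ f)
  isInt-sum {zero}  f f-int = + 0 , refl
  isInt-sum {suc n} f f-int = isInt-+ (f-int zero) (isInt-sum (f ∘ suc) (f-int ∘ suc))

  κ : ℕ → ℚ
  κ m = + m / suc m

  κ<1 : ∀ m → κ m < 1ℚ
  κ<1 m = ℚP.toℚᵘ-cancel-<
    (ℚᵘP.<-respˡ-≃ (ℚᵘP.≃-sym (ℚP.toℚᵘ-fromℚᵘ (ℚᵘ.mkℚᵘ (+ m) m)))
      (ℚᵘ.*<* (subst₂ ℤ._<_ (sym (ℤP.*-identityʳ (+ m))) (sym (ℤP.*-identityˡ (+ suc m)))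
        (+<+ ℕP.≤-refl))))

  ≤κ-if-integral : ∀ m {x} → x < 1ℚ → IsInt (x * fromℤ (+ suc m)) → x ≤ κ m
  ≤κ-if-integral m {x} x<1 (t , x*n≡t) = ℚP.*-cancelʳ-≤-pos n {{n>0}} (begin
    x * n              ≡⟨ x*n≡t ⟩
    fromℤ t            ≤⟨ fromℤ-mono-≤ (ℤP.i<j⇒i≤pred[j] (fromℤ-cancel-< {t} {+ suc m} t<n)) ⟩
    fromℤ (+ m)        ≡⟨ z/n*n≡z (+ m) m ⟨
    κ m * n            ∎)
    where
    open ℚP.≤-Reasoning
    n : ℚ
    n = fromℤ (+ suc m)
    n>0 : ℚ.Positive n
    n>0 = fromℤ-+[1+n]-pos m
    t<n : fromℤ t < n
    t<n = subst₂ _<_ x*n≡t (ℚP.*-identityˡ n) (ℚP.*-monoˡ-<-pos n {{n>0}} x<1)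

  -- Finite sums and dot products

  sum-neg : ∀ {n} (f : Fin n → ℚ) → sumℚ (λ i → - f i) ≡ - sumℚ f
  sum-neg {zero}  f = refl
  sum-neg {suc n} f = trans (cong (_+_ (- f zero)) (sum-neg (f ∘ suc))) (sym (ℚP.neg-distrib-+ (f zero) _))

  sum-const : ∀ n x → sumℚ {n} (λ _ → x) ≡ fromℤ (+ n) * x
  sum-const zero    x = sym (ℚP.*-zeroˡ x)
  sum-const (suc n) x = begin
    x + sumℚ {n} (λ _ → x)       ≡⟨ cong (_+_ x) (sum-const n x) ⟩
    x + fromℤ (+ n) * x          ≡⟨ cong (_+ fromℤ (+ n) * x) (ℚP.*-identityˡ x) ⟨
    1ℚ * x + fromℤ (+ n) * x     ≡⟨ ℚP.*-distribʳ-+ x 1ℚ (fromℤ (+ n)) ⟨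
    (1ℚ + fromℤ (+ n)) * x       ≡⟨ cong (_* x) (fromℤ-+ (+ 1) (+ n)) ⟨
    fromℤ (+ suc n) * x          ∎
    where open ≡-Reasoning

  sum-single : ∀ {n} (f : Fin n → ℚ) j → (∀ i → i ≢ j → f i ≡ 0ℚ) → sumℚ f ≡ f j
  sum-single {suc n} f j f≡0 = begin
    sumℚ f                        ≡⟨ sum-remove {i = j} f ⟩
    f j + sumℚ (f ∘ punchIn j)    ≡⟨ cong (_+_ (f j)) (sum-cong-≗ (λ k → f≡0 (punchIn j k) (punchInᵢ≢i j k))) ⟩
    f j + sumℚ {n} (λ _ → 0ℚ)     ≡⟨ cong (_+_ (f j)) (sum-replicate-zero n) ⟩
    f j + 0ℚ                      ≡⟨ ℚP.+-identityʳ (f j) ⟩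
    f j                           ∎
    where open ≡-Reasoning

  sum-mono-≤ : ∀ {n} {f g : Fin n → ℚ} → (∀ i → f i ≤ g i) → sumℚ f ≤ sumℚ g
  sum-mono-≤ {zero}  f≤g = ℚP.≤-refl
  sum-mono-≤ {suc n} f≤g = ℚP.+-mono-≤ (f≤g zero) (sum-mono-≤ (f≤g ∘ suc))

  sum-nonNeg : ∀ {n} (f : Fin n → ℚ) → (∀ i → 0ℚ ≤ f i) → 0ℚ ≤ sumℚ f
  sum-nonNeg {n} f f≥0 = subst (_≤ sumℚ f) (sum-replicate-zero n) (sum-mono-≤ f≥0)

  sum-nonNeg-≡0 : ∀ {n} (f : Fin n → ℚ) → (∀ i → 0ℚ ≤ f i) → sumℚ f ≡ 0ℚ → ∀ i → f i ≡ 0ℚ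
  sum-nonNeg-≡0 {suc n} f f≥0 ∑f≡0 i = ℚP.≤-antisym fi≤0 (f≥0 i)
    where
    rest≥0 : 0ℚ ≤ sumℚ (f ∘ punchIn i)
    rest≥0 = sum-nonNeg (f ∘ punchIn i) (f≥0 ∘ punchIn i)
    fi≤0 : f i ≤ 0ℚ
    fi≤0 = begin
      f i                           ≡⟨ ℚP.+-identityʳ (f i) ⟨
      f i + 0ℚ                      ≤⟨ ℚP.+-monoʳ-≤ (f i) rest≥0 ⟩
      f i + sumℚ (f ∘ punchIn i)    ≡⟨ sum-remove {i = i} f ⟨
      sumℚ f                        ≡⟨ ∑f≡0 ⟩
      0ℚ                            ∎
      where open ℚP.≤-Reasoning

  sum≢0⇒∃≢0 : ∀ {n} (f : Fin n → ℚ) → sumℚ f ≢ 0ℚ → Σ (Fin n) λ i → f i ≢ 0ℚ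
  sum≢0⇒∃≢0 {zero}  f ∑f≢0 = ⊥-elim (∑f≢0 refl)
  sum≢0⇒∃≢0 {suc n} f ∑f≢0 with f zero ℚP.≟ 0ℚ
  ... | no f₀≢0 = zero , f₀≢0
  ... | yes f₀≡0 =
    let i , fᵢ≢0 = sum≢0⇒∃≢0 (f ∘ suc) (λ ∑≡0 → ∑f≢0 (cong₂ _+_ f₀≡0 ∑≡0)) in suc i , fᵢ≢0

  ≗-from-init-and-sum : ∀ {n} (u v : Fin (suc n) → ℚ) →
    (∀ k → u (inject₁ k) ≡ v (inject₁ k)) → sumℚ u ≡ sumℚ v → ∀ i → u i ≡ v i
  ≗-from-init-and-sum {n} u v init≡ ∑≡ i with view i
  ... | ‵inject₁ k = init≡ k
  ... | ‵fromℕ = +-cancelˡ (sumℚ (init v)) (u (fromℕ n)) (v (fromℕ n)) (begin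
    sumℚ (init v) + u (fromℕ n)  ≡⟨ cong (_+ u (fromℕ n)) (sum-cong-≗ init≡) ⟨
    sumℚ (init u) + u (fromℕ n)  ≡⟨ sum-init-last u ⟨
    sumℚ u                       ≡⟨ ∑≡ ⟩
    sumℚ v                       ≡⟨ sum-init-last v ⟩
    sumℚ (init v) + v (fromℕ n)  ∎)
    where open ≡-Reasoning

  dot-comm : ∀ {d} (x y : Point d) → dot x y ≡ dot y x
  dot-comm x y = sum-cong-≗ (λ k → ℚP.*-comm (x k) (y k))

  dot-congʳ : ∀ {d} (x : Point d) {y y′ : Point d} → (∀ k → y k ≡ y′ k) → dot x y ≡ dot x y′
  dot-congʳ x y≗y′ = sum-cong-≗ (λ k → cong (x k *_) (y≗y′ k))

  dot-scaleˡ : ∀ {d} c (x y : Point d) → dot (λ k → c * x k) y ≡ c * dot x y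
  dot-scaleˡ c x y = trans (sum-cong-≗ (λ k → ℚP.*-assoc c (x k) (y k))) (sym (*-distribˡ-sum c (λ k → x k * y k)))

  dot-scaleʳ : ∀ {d} c (x y : Point d) → dot x (λ k → c * y k) ≡ c * dot x y
  dot-scaleʳ c x y = trans (dot-comm x _) (trans (dot-scaleˡ c y x) (cong (c *_) (dot-comm y x)))

  dot-zeroˡ : ∀ {d} (y : Point d) → dot (λ _ → 0ℚ) y ≡ 0ℚ
  dot-zeroˡ {d} y = trans (sum-cong-≗ (λ k → ℚP.*-zeroˡ (y k))) (sum-replicate-zero d)

  dot-∑ˡ : ∀ {n d} (V : Fin n → Point d) y → sumℚ (λ i → dot (V i) y) ≡ dot (λ k → sumℚ (λ i → V i k)) y
  dot-∑ˡ V y = begin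
    sumℚ (λ i → sumℚ (λ k → V i k * y k))    ≡⟨ ∑-comm (λ i k → V i k * y k) ⟩
    sumℚ (λ k → sumℚ (λ i → V i k * y k))    ≡⟨ sum-cong-≗ (λ k → *-distribʳ-sum (y k) (λ i → V i k)) ⟨
    sumℚ (λ k → sumℚ (λ i → V i k) * y k)    ∎
    where open ≡-Reasoning

  dot-combinationˡ : ∀ {n d} (c : Fin n → ℚ) (V : Fin n → Point d) y →
    dot (λ k → sumℚ (λ i → c i * V i k)) y ≡ sumℚ (λ i → c i * dot (V i) y)
  dot-combinationˡ c V y =
    trans (sym (dot-∑ˡ (λ i k → c i * V i k) y)) (sum-cong-≗ (λ i → dot-scaleˡ (c i) (V i) y))

  dot-combinationʳ : ∀ {n d} (c : Fin n → ℚ) (V : Fin n → Point d) x →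
    dot x (λ k → sumℚ (λ i → c i * V i k)) ≡ sumℚ (λ i → c i * dot x (V i))
  dot-combinationʳ c V x = trans (dot-comm x _)
    (trans (dot-combinationˡ c V x) (sum-cong-≗ (λ i → cong (c i *_) (dot-comm (V i) x))))

  dot-init : ∀ {m} (u v : Point (suc m)) → v (fromℕ m) ≡ 0ℚ → dot (init u) (init v) ≡ dot u v
  dot-init {m} u v vₘ≡0 = sym (begin
    dot u v                                     ≡⟨ sum-init-last (λ k → u k * v k) ⟩
    dot (init u) (init v) + u (fromℕ m) * v (fromℕ m)  ≡⟨ cong (λ t → dot (init u) (init v) + u (fromℕ m) * t) vₘ≡0 ⟩
    dot (init u) (init v) + u (fromℕ m) * 0ℚ    ≡⟨ cong (_+_ (dot (init u) (init v))) (ℚP.*-zeroʳ (u (fromℕ m))) ⟩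
    dot (init u) (init v) + 0ℚ                  ≡⟨ ℚP.+-identityʳ _ ⟩
    dot (init u) (init v)                       ∎)
    where open ≡-Reasoning

  dot-shiftʳ : ∀ {d} (u v : Point d) a → sumℚ u ≡ 0ℚ → dot u (λ k → v k + - a) ≡ dot u v
  dot-shiftʳ u v a ∑u≡0 = begin
    sumℚ (λ k → u k * (v k + - a))              ≡⟨ sum-cong-≗ (λ k → solve 3 (λ x y z → x :* (y :+ :- z) := x :* y :+ :- z :* x) refl (u k) (v k) a) ⟩
    sumℚ (λ k → u k * v k + - a * u k)          ≡⟨ ∑-distrib-+ (λ k → u k * v k) (λ k → - a * u k) ⟩
    dot u v + sumℚ (λ k → - a * u k)            ≡⟨ cong (_+_ (dot u v)) (*-distribˡ-sum (- a) u) ⟨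
    dot u v + - a * sumℚ u                      ≡⟨ cong (λ t → dot u v + - a * t) ∑u≡0 ⟩
    dot u v + - a * 0ℚ                          ≡⟨ cong (_+_ (dot u v)) (ℚP.*-zeroʳ (- a)) ⟩
    dot u v + 0ℚ                                ≡⟨ ℚP.+-identityʳ _ ⟩
    dot u v                                     ∎
    where open ≡-Reasoning

  -- Convex hulls and duality

  p*q≡0⇒q≡0 : ∀ {p q} → p ≢ 0ℚ → p * q ≡ 0ℚ → q ≡ 0ℚ
  p*q≡0⇒q≡0 {p} {q} p≢0 p*q≡0 = begin
    q                ≡⟨ ℚP.*-identityˡ q ⟨
    1ℚ * q           ≡⟨ cong (_* q) (ℚP.*-inverseˡ p) ⟨
    (1/ p * p) * q   ≡⟨ ℚP.*-assoc (1/ p) p q ⟩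
    1/ p * (p * q)   ≡⟨ cong (1/ p *_) p*q≡0 ⟩
    1/ p * 0ℚ        ≡⟨ ℚP.*-zeroʳ (1/ p) ⟩
    0ℚ               ∎
    where
    open ≡-Reasoning
    instance _ = ℚ.≢-nonZero p≢0

  kronecker : ∀ {n} → Fin n → Fin n → ℚ
  kronecker j i = if ⌊ j ≟ i ⌋ then 1ℚ else 0ℚ

  kronecker-off : ∀ {n} {j i : Fin n} → i ≢ j → kronecker j i ≡ 0ℚ
  kronecker-off {j = j} {i} i≢j with j ≟ i
  ... | yes j≡i = ⊥-elim (i≢j (sym j≡i))
  ... | no _    = refl

  kronecker-diag : ∀ {n} (j : Fin n) → kronecker j j ≡ 1ℚ
  kronecker-diag j with j ≟ j
  ... | yes _   = refl
  ... | no j≢j  = ⊥-elim (j≢j refl)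

  kronecker-nonNeg : ∀ {n} (j i : Fin n) → 0ℚ ≤ kronecker j i
  kronecker-nonNeg j i with j ≟ i
  ... | yes _ = ℚP.<⇒≤ (ℚP.positive⁻¹ 1ℚ)
  ... | no _  = ℚP.≤-refl

  sum-kronecker* : ∀ {n} (j : Fin n) (f : Fin n → ℚ) → sumℚ (λ i → kronecker j i * f i) ≡ f j
  sum-kronecker* j f = begin
    sumℚ (λ i → kronecker j i * f i)  ≡⟨ sum-single (λ i → kronecker j i * f i) j
                                           (λ i i≢j → trans (cong (_* f i) (kronecker-off i≢j)) (ℚP.*-zeroˡ (f i))) ⟩
    kronecker j j * f j               ≡⟨ cong (_* f j) (kronecker-diag j) ⟩
    1ℚ * f j                          ≡⟨ ℚP.*-identityˡ (f j) ⟩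
    f j                               ∎
    where open ≡-Reasoning

  vertex∈hull : ∀ {n d} (V : Fin n → Point d) j → InConvHull V (V j)
  vertex∈hull V j =
      kronecker j
    , kronecker-nonNeg j
    , trans (sum-single (kronecker j) j (λ i → kronecker-off)) (kronecker-diag j)
    , λ k → sum-kronecker* j (λ i → V i k)

  vertices-in-dual⇒dual : ∀ {n d} (V : Fin n → Point d) y → (∀ i → - 1ℚ ≤ dot (V i) y) → Dual (InConvHull V) y
  vertices-in-dual⇒dual V y V≥-1 x (c , c≥0 , ∑c≡1 , c-combines) = begin
    - 1ℚ                                 ≡⟨ ℚP.*-identityˡ (- 1ℚ) ⟨
    1ℚ * - 1ℚ                            ≡⟨ cong (_* - 1ℚ) ∑c≡1 ⟨
    sumℚ c * - 1ℚ                        ≡⟨ *-distribʳ-sum (- 1ℚ) c ⟩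
    sumℚ (λ i → c i * - 1ℚ)              ≤⟨ sum-mono-≤ (λ i → ℚP.*-monoˡ-≤-nonNeg (c i) {{ℚ.nonNegative (c≥0 i)}} (V≥-1 i)) ⟩
    sumℚ (λ i → c i * dot (V i) y)       ≡⟨ dot-combinationˡ c V y ⟨
    dot (λ k → sumℚ (λ i → c i * V i k)) y  ≡⟨ sum-cong-≗ (λ k → cong (_* y k) (c-combines k)) ⟩
    dot x y                              ∎
    where open ℚP.≤-Reasoning

  tight-on-support : ∀ {K} (γ a : Fin K → ℚ) β → (∀ k → 0ℚ ≤ γ k) → sumℚ γ ≡ 1ℚ →
    (∀ k → β ≤ a k) → sumℚ (λ k → γ k * a k) ≡ β → ∀ k → γ k ≢ 0ℚ → a k ≡ β
  tight-on-support {K} γ a β γ≥0 ∑γ≡1 β≤a ∑γa≡β k γₖ≢0 =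
    x-y≡0⇒x≡y (a k) β (p*q≡0⇒q≡0 γₖ≢0 (sum-nonNeg-≡0 slack slack≥0 ∑slack≡0 k))
    where
    open ≡-Reasoning
    slack : Fin K → ℚ
    slack k = γ k * (a k + - β)
    slack≥0 : ∀ k → 0ℚ ≤ slack k
    slack≥0 k = ℚP.nonNegative⁻¹ (slack k) {{ℚP.nonNeg*nonNeg⇒nonNeg (γ k) {{ℚ.nonNegative (γ≥0 k)}} _
      {{ℚ.nonNegative (subst (_≤ a k + - β) (ℚP.+-inverseʳ β) (ℚP.+-monoˡ-≤ (- β) (β≤a k)))}}}}
    ∑slack≡0 : sumℚ slack ≡ 0ℚ
    ∑slack≡0 = begin
      sumℚ slack                                    ≡⟨ sum-cong-≗ (λ k → solve 3 (λ g x b → g :* (x :+ :- b) := g :* x :+ :- b :* g) refl (γ k) (a k) β) ⟩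
      sumℚ (λ k → γ k * a k + - β * γ k)            ≡⟨ ∑-distrib-+ (λ k → γ k * a k) (λ k → - β * γ k) ⟩
      sumℚ (λ k → γ k * a k) + sumℚ (λ k → - β * γ k)  ≡⟨ cong₂ _+_ ∑γa≡β (sym (*-distribˡ-sum (- β) γ)) ⟩
      β + - β * sumℚ γ                              ≡⟨ cong (λ t → β + - β * t) ∑γ≡1 ⟩
      β + - β * 1ℚ                                  ≡⟨ solve 1 (λ b → b :+ :- b :* con 1ℚ := con 0ℚ) refl β ⟩
      0ℚ                                            ∎

  dual-vertex-on-facets : ∀ {n d K} (V : Fin n → Point d) (W : Fin K → Point d) →
    (∀ y → Dual (InConvHull V) y ⇔ InConvHull W y) → ∀ y → Dual (InConvHull V) y →
    Σ (Fin K) λ k → ∀ i → dot (V i) y ≡ - 1ℚ → dot (V i) (W k) ≡ - 1ℚ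
  dual-vertex-on-facets {K = K} V W dual⇔hull y y∈dual = on-support (Equivalence.to (dual⇔hull y) y∈dual)
    where
    on-support : InConvHull W y → Σ (Fin K) λ k → ∀ i → dot (V i) y ≡ - 1ℚ → dot (V i) (W k) ≡ - 1ℚ
    on-support (γ , γ≥0 , ∑γ≡1 , γ-combines) =
      let k₀ , γₖ₀≢0 = sum≢0⇒∃≢0 γ (λ ∑γ≡0 → 1ℚ≢0ℚ (trans (sym ∑γ≡1) ∑γ≡0)) in
      k₀ , λ i ⟨Vᵢ,y⟩≡-1 → tight-on-support γ (λ k → dot (V i) (W k)) (- 1ℚ) γ≥0 ∑γ≡1
             (λ k → Equivalence.from (dual⇔hull (W k)) (vertex∈hull W k) (V i) (vertex∈hull V i))
             (trans (sym (dot-combinationʳ γ W (V i))) (trans (dot-congʳ (V i) γ-combines) ⟨Vᵢ,y⟩≡-1))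
             k₀ γₖ₀≢0
      where
      1ℚ≢0ℚ : 1ℚ ≢ 0ℚ
      1ℚ≢0ℚ ()

  -- The Laplacian

  countTrue : ∀ {n} → (Fin n → Bool) → ℕ
  countTrue = foldr (λ b c → if b then suc c else c) 0

  sum-negIndicator : ∀ {n} (b : Fin n → Bool) →
    sumℚ (λ k → fromℤ (if b k then -[1+ 0 ] else + 0)) ≡ - fromℤ (+ countTrue b)
  sum-negIndicator {zero}  b = refl
  sum-negIndicator {suc n} b with b zero | sum-negIndicator (b ∘ suc)
  ... | false | ∑≡-c = trans (ℚP.+-identityˡ _) ∑≡-c
  ... | true  | ∑≡-c = begin
    - 1ℚ + sumℚ (λ k → fromℤ (if b (suc k) then -[1+ 0 ] else + 0))  ≡⟨ cong (_+_ (- 1ℚ)) ∑≡-c ⟩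
    - 1ℚ + - fromℤ (+ c)          ≡⟨ ℚP.neg-distrib-+ 1ℚ (fromℤ (+ c)) ⟨
    - (1ℚ + fromℤ (+ c))          ≡⟨ cong -_ (fromℤ-+ (+ 1) (+ c)) ⟨
    - fromℤ (+ suc c)             ∎
    where
    open ≡-Reasoning
    c : ℕ
    c = countTrue (b ∘ suc)

  module _ {n} (G : SimpleGraph n) where

    lapℚ : Fin n → Fin n → ℚ
    lapℚ i k = fromℤ (laplacian G i k)

    laplacian-sym : ∀ i k → laplacian G i k ≡ laplacian G k i
    laplacian-sym i k with i ≟ k | k ≟ i
    ... | yes refl | yes _    = refl
    ... | yes refl | no k≢k   = ⊥-elim (k≢k refl)
    ... | no i≢i   | yes refl = ⊥-elim (i≢i refl)
    ... | no _     | no _     = cong (λ b → if b then -[1+ 0 ] else + 0) (SimpleGraph.sym G i k)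

    lapℚ-diagonal+adjacency : ∀ i k →
      lapℚ i k ≡ kronecker i k * fromℤ (+ deg G i) + fromℤ (if adj G i k then -[1+ 0 ] else + 0)
    lapℚ-diagonal+adjacency i k with i ≟ k
    ... | yes refl rewrite irrefl G i = sym (trans (ℚP.+-identityʳ _) (ℚP.*-identityˡ _))
    ... | no _ = sym (trans (cong (_+ fromℤ (if adj G i k then -[1+ 0 ] else + 0)) (ℚP.*-zeroˡ (fromℤ (+ deg G i))))
                           (ℚP.+-identityˡ _))

    lapℚ-rowSum : ∀ i → sumℚ (lapℚ i) ≡ 0ℚ
    lapℚ-rowSum i = begin
      sumℚ (lapℚ i)                                      ≡⟨ sum-cong-≗ (lapℚ-diagonal+adjacency i) ⟩
      sumℚ (λ k → kronecker i k * dᵢ + aᵢ k)             ≡⟨ ∑-distrib-+ (λ k → kronecker i k * dᵢ) aᵢ ⟩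
      sumℚ (λ k → kronecker i k * dᵢ) + sumℚ aᵢ          ≡⟨ cong₂ _+_ (sum-kronecker* i (λ _ → dᵢ)) (sum-negIndicator (adj G i)) ⟩
      dᵢ + - dᵢ                                          ≡⟨ ℚP.+-inverseʳ dᵢ ⟩
      0ℚ                                                 ∎
      where
      open ≡-Reasoning
      dᵢ : ℚ
      dᵢ = fromℤ (+ deg G i)
      aᵢ : Fin n → ℚ
      aᵢ k = fromℤ (if adj G i k then -[1+ 0 ] else + 0)

    lapℚ-colSum : ∀ k → sumℚ (λ i → lapℚ i k) ≡ 0ℚ
    lapℚ-colSum k = trans (sum-cong-≗ (λ i → cong fromℤ (laplacian-sym i k))) (lapℚ-rowSum k)

  -- The Laplacian simplex and the map f

  ε/[1+N]-pos : ∀ {ε} N → 0ℚ < ε → ℚ.Positive (ε * (+ 1 / suc N))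
  ε/[1+N]-pos {ε} N ε>0 = ℚP.pos*pos⇒pos ε {{ℚ.positive ε>0}} (+ 1 / suc N) {{ℚP.normalize-pos 1 (suc N)}}

  ∣ε/[1+N]*a∣<ε : ∀ {ε a} N → 0ℚ < ε → ∣ a ∣ ≤ fromℤ (+ N) → ∣ ε * (+ 1 / suc N) * a ∣ < ε
  ∣ε/[1+N]*a∣<ε {ε} {a} N ε>0 ∣a∣≤N = begin-strict
    ∣ s * a ∣                  ≡⟨ ℚP.∣p*q∣≡∣p∣*∣q∣ s a ⟩
    ∣ s ∣ * ∣ a ∣              ≡⟨ cong (_* ∣ a ∣) (ℚP.0≤p⇒∣p∣≡p (ℚP.<⇒≤ (ℚP.positive⁻¹ s))) ⟩
    s * ∣ a ∣                  ≤⟨ ℚP.*-monoˡ-≤-nonNeg s ∣a∣≤N ⟩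
    s * fromℤ (+ N)            <⟨ ℚP.*-monoʳ-<-pos s (fromℤ-mono-< (+<+ (ℕP.n<1+n N))) ⟩
    s * fromℤ (+ suc N)        ≡⟨ ℚP.*-assoc ε (+ 1 / suc N) (fromℤ (+ suc N)) ⟩
    ε * (+ 1 / suc N * fromℤ (+ suc N))  ≡⟨ cong (ε *_) (z/n*n≡z (+ 1) N) ⟩
    ε * 1ℚ                     ≡⟨ ℚP.*-identityʳ ε ⟩
    ε                          ∎
    where
    open ℚP.≤-Reasoning
    s : ℚ
    s = ε * (+ 1 / suc N)
    instance
      s>0 : ℚ.Positive s
      s>0 = ε/[1+N]-pos N ε>0
      s≥0 : ℚ.NonNegative s
      s≥0 = ℚP.pos⇒nonNeg s

  peak : ∀ {m} → Fin (suc m) → Fin (suc m) → ℚ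
  peak {m} j i = if ⌊ j ≟ i ⌋ then fromℤ (+ m) else - 1ℚ

  peak-off : ∀ {m} {j i : Fin (suc m)} → i ≢ j → peak j i ≡ - 1ℚ
  peak-off {j = j} {i} i≢j with j ≟ i
  ... | yes j≡i = ⊥-elim (i≢j (sym j≡i))
  ... | no _    = refl

  peak-diag : ∀ {m} (j : Fin (suc m)) → peak j j ≡ fromℤ (+ m)
  peak-diag j with j ≟ j
  ... | yes _  = refl
  ... | no j≢j = ⊥-elim (j≢j refl)

  peak≥-1 : ∀ {m} (j i : Fin (suc m)) → - 1ℚ ≤ peak j i
  peak≥-1 {m} j i with j ≟ i
  ... | yes _ = fromℤ-mono-≤ { -[1+ 0 ]} {+ m} ℤ.-≤+
  ... | no _  = ℚP.≤-refl

  ∣peak∣≤1+m : ∀ {m} (j i : Fin (suc m)) → ∣ peak j i ∣ ≤ fromℤ (+ suc m)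
  ∣peak∣≤1+m {m} j i with j ≟ i
  ... | yes _ = subst (_≤ fromℤ (+ suc m)) (sym (ℚP.0≤p⇒∣p∣≡p (fromℤ-mono-≤ {+ 0} {+ m} (+≤+ z≤n))))
                  (fromℤ-mono-≤ {+ m} (+≤+ (ℕP.n≤1+n m)))
  ... | no _  = fromℤ-mono-≤ {+ 1} {+ suc m} (+≤+ (s≤s z≤n))

  sum-peak : ∀ {m} (j : Fin (suc m)) → sumℚ (peak j) ≡ 0ℚ
  sum-peak {m} j = begin
    sumℚ (peak j)                          ≡⟨ sum-remove {i = j} (peak j) ⟩
    peak j j + sumℚ (peak j ∘ punchIn j)   ≡⟨ cong₂ _+_ (peak-diag j) (sum-cong-≗ (λ k → peak-off (punchInᵢ≢i j k))) ⟩
    fromℤ (+ m) + sumℚ {m} (λ _ → - 1ℚ)    ≡⟨ cong (_+_ (fromℤ (+ m))) (sum-const m (- 1ℚ)) ⟩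
    fromℤ (+ m) + fromℤ (+ m) * - 1ℚ       ≡⟨ solve 1 (λ x → x :+ x :* :- con 1ℚ := con 0ℚ) refl (fromℤ (+ m)) ⟩
    0ℚ                                     ∎
    where open ≡-Reasoning

  fΛ-involutive : ∀ {m} (l : Fin (suc m) → ℚ) i → fΛ (fΛ l) i ≡ l i
  fΛ-involutive {m} l i = solve 2 (λ q x → q :+ :- (q :+ :- x) := x) refl (κ m) (l i)

  fΛ-injective : ∀ {m} (l l′ : Fin (suc m) → ℚ) → (∀ i → fΛ l i ≡ fΛ l′ i) → ∀ i → l i ≡ l′ i
  fΛ-injective {m} l l′ fl≗fl′ i = ℚP.neg-injective (+-cancelˡ (κ m) (- l i) (- l′ i) (fl≗fl′ i))

  ht-fΛ : ∀ {m} (l : Fin (suc m) → ℚ) → ht (fΛ l) ≡ fromℤ (+ m) + - ht l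
  ht-fΛ {m} l = begin
    sumℚ (λ i → κ m + - l i)                        ≡⟨ ∑-distrib-+ (λ _ → κ m) (λ i → - l i) ⟩
    sumℚ {suc m} (λ _ → κ m) + sumℚ (λ i → - l i)   ≡⟨ cong₂ _+_ (sum-const (suc m) (κ m)) (sum-neg l) ⟩
    fromℤ (+ suc m) * κ m + - ht l                  ≡⟨ cong (_+ - ht l) (ℚP.*-comm (fromℤ (+ suc m)) (κ m)) ⟩
    κ m * fromℤ (+ suc m) + - ht l                  ≡⟨ cong (_+ - ht l) (z/n*n≡z (+ m) m) ⟩
    fromℤ (+ m) + - ht l                            ∎
    where open ≡-Reasoning

  ht-fΛ-iff : ∀ {m} (l : Fin (suc m) → ℚ) (i : ℤ) → (ht l ≡ fromℤ i) ⇔ (ht (fΛ l) ≡ fromℤ (+ m ℤ.- i))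
  ht-fΛ-iff {m} l i = mk⇔ to from
    where
    open ≡-Reasoning
    M : ℚ
    M = fromℤ (+ m)
    M-i : fromℤ (+ m ℤ.- i) ≡ M + - fromℤ i
    M-i = trans (fromℤ-+ (+ m) (ℤ.- i)) (cong (_+_ M) (fromℤ-neg i))
    to : ht l ≡ fromℤ i → ht (fΛ l) ≡ fromℤ (+ m ℤ.- i)
    to htl≡i = trans (ht-fΛ l) (trans (cong (λ t → M + - t) htl≡i) (sym M-i))
    from : ht (fΛ l) ≡ fromℤ (+ m ℤ.- i) → ht l ≡ fromℤ i
    from htfl≡m-i = begin
      ht l                    ≡⟨ solve 2 (λ a h → h := a :+ :- (a :+ :- h)) refl M (ht l) ⟩
      M + - (M + - ht l)      ≡⟨ cong (λ t → M + - t) (trans (sym (ht-fΛ l)) (trans htfl≡m-i M-i)) ⟩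
      M + - (M + - fromℤ i)   ≡⟨ solve 2 (λ a h → a :+ :- (a :+ :- h) := h) refl M (fromℤ i) ⟩
      fromℤ i                 ∎

  ht-fΛ-level : ∀ {m i} (l : Fin (suc m) → ℚ) → i ℕ.≤ m →
    (ht l ≡ fromℤ (+ i)) ⇔ (ht (fΛ l) ≡ fromℤ (+ (m ℕ.∸ i)))
  ht-fΛ-level {m} {i} l i≤m = mk⇔
    (λ htl≡i → trans (Equivalence.to (ht-fΛ-iff l (+ i)) htl≡i) (cong fromℤ m-i≡m∸i))
    (λ htfl≡m∸i → Equivalence.from (ht-fΛ-iff l (+ i)) (trans htfl≡m∸i (cong fromℤ (sym m-i≡m∸i))))
    where
    m-i≡m∸i : + m ℤ.- + i ≡ + (m ℕ.∸ i)
    m-i≡m∸i = trans (ℤP.m-n≡m⊖n m i) (ℤP.⊖-≥ i≤m)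

  ht-fΛ∘fΛ : ∀ {m} (l : Fin (suc m) → ℚ) → ht (fΛ (fΛ l)) ≡ ht l
  ht-fΛ∘fΛ l = sum-cong-≗ (fΛ-involutive l)

  module _ {m} (G : SimpleGraph (suc m)) where

    lapVert-sum : ∀ k → sumℚ (λ i → lapVert G i k) ≡ 0ℚ
    lapVert-sum k = lapℚ-colSum G (inject₁ k)

    sum-dot-lapVert : ∀ y → sumℚ (λ i → dot (lapVert G i) y) ≡ 0ℚ
    sum-dot-lapVert y =
      trans (dot-∑ˡ (lapVert G) y) (trans (sum-cong-≗ (λ k → cong (_* y k) (lapVert-sum k))) (dot-zeroˡ y))

    dot-lapVert-differences : ∀ (c : Fin (suc m) → ℚ) i →
      dot (lapVert G i) (init (λ k → c k + - c (fromℕ m))) ≡ sumℚ (λ i′ → c i′ * lapℚ G i′ i)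
    dot-lapVert-differences c i = begin
      dot (init (lapℚ G i)) (init (λ k → c k + - c (fromℕ m)))
        ≡⟨ dot-init (lapℚ G i) (λ k → c k + - c (fromℕ m)) (ℚP.+-inverseʳ (c (fromℕ m))) ⟩
      dot (lapℚ G i) (λ k → c k + - c (fromℕ m))
        ≡⟨ dot-shiftʳ (lapℚ G i) c (c (fromℕ m)) (lapℚ-rowSum G i) ⟩
      dot (lapℚ G i) c
        ≡⟨ sum-cong-≗ (λ k → trans (ℚP.*-comm (lapℚ G i k) (c k)) (cong (λ z → c k * fromℤ z) (laplacian-sym G i k))) ⟩
      sumℚ (λ k → c k * lapℚ G k i)
        ∎
      where open ≡-Reasoning

    hull-coefficients-realise : ∀ (b c : Fin (suc m) → ℚ) → sumℚ b ≡ 0ℚ →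
      (∀ k → sumℚ (λ i → c i * lapVert G i k) ≡ b (inject₁ k)) →
      ∀ k → sumℚ (λ i → c i * lapℚ G i k) ≡ b k
    hull-coefficients-realise b c ∑b≡0 c-combines =
      ≗-from-init-and-sum (λ k → sumℚ (λ i → c i * lapℚ G i k)) b c-combines (trans ∑cL≡0 (sym ∑b≡0))
      where
      open ≡-Reasoning
      ∑cL≡0 : sumℚ (λ k → sumℚ (λ i → c i * lapℚ G i k)) ≡ 0ℚ
      ∑cL≡0 = begin
        sumℚ (λ k → sumℚ (λ i → c i * lapℚ G i k))  ≡⟨ ∑-comm (λ i k → c i * lapℚ G i k) ⟨
        sumℚ (λ i → sumℚ (λ k → c i * lapℚ G i k))  ≡⟨ sum-cong-≗ (λ i → *-distribˡ-sum (c i) (lapℚ G i)) ⟨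
        sumℚ (λ i → c i * sumℚ (lapℚ G i))          ≡⟨ sum-cong-≗ (λ i → trans (cong (c i *_) (lapℚ-rowSum G i)) (ℚP.*-zeroʳ (c i))) ⟩
        sumℚ {suc m} (λ _ → 0ℚ)                     ≡⟨ sum-replicate-zero (suc m) ⟩
        0ℚ                                          ∎

    functional-from-hull : ∀ (b : Fin (suc m) → ℚ) → sumℚ b ≡ 0ℚ → InConvHull (lapVert G) (init b) →
      Σ (Point m) λ y → ∀ i → dot (lapVert G i) y ≡ b i
    functional-from-hull b ∑b≡0 (c , _ , _ , c-combines) =
        init (λ k → c k + - c (fromℕ m))
      , λ i → trans (dot-lapVert-differences c i) (hull-coefficients-realise b c ∑b≡0 c-combines i)

    -- Shrink b into the ε-box around the origin, realise it there, and scale the functional back.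
    interior⇒functional : OriginInInterior (InConvHull (lapVert G)) →
      ∀ N (b : Fin (suc m) → ℚ) → sumℚ b ≡ 0ℚ → (∀ i → ∣ b i ∣ ≤ fromℤ (+ N)) →
      Σ (Point m) λ y → ∀ i → dot (lapVert G i) y ≡ b i
    interior⇒functional (ε , ε>0 , box) N b ∑b≡0 ∣b∣≤N =
      let y , y-values = functional-from-hull sb ∑sb≡0 (box (init sb) (λ k → ∣ε/[1+N]*a∣<ε N ε>0 (∣b∣≤N (inject₁ k))))
      in (λ k → 1/ s * y k) , λ i → begin
        dot (lapVert G i) (λ k → 1/ s * y k)  ≡⟨ dot-scaleʳ (1/ s) (lapVert G i) y ⟩
        1/ s * dot (lapVert G i) y            ≡⟨ cong (1/ s *_) (y-values i) ⟩
        1/ s * (s * b i)                      ≡⟨ ℚP.*-assoc (1/ s) s (b i) ⟨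
        (1/ s * s) * b i                      ≡⟨ cong (_* b i) (ℚP.*-inverseˡ s) ⟩
        1ℚ * b i                              ≡⟨ ℚP.*-identityˡ (b i) ⟩
        b i                                   ∎
      where
      open ≡-Reasoning
      s : ℚ
      s = ε * (+ 1 / suc N)
      instance
        s≢0 : ℚ.NonZero s
        s≢0 = ℚP.pos⇒nonZero s {{ε/[1+N]-pos N ε>0}}
      sb : Fin (suc m) → ℚ
      sb i = s * b i
      ∑sb≡0 : sumℚ sb ≡ 0ℚ
      ∑sb≡0 = trans (sym (*-distribˡ-sum s b)) (trans (cong (s *_) ∑b≡0) (ℚP.*-zeroʳ s))

    reflexive⇒tight-lattice-point : IsReflexive (lapVert G) → ∀ j →
      Σ (Fin m → ℤ) λ z → ∀ i → i ≢ j → dot (lapVert G i) (λ k → fromℤ (z k)) ≡ - 1ℚ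
    reflexive⇒tight-lattice-point (interior , _ , ws , dual⇔hull) j =
      let y , y-values = interior⇒functional interior (suc m) (peak j) (sum-peak j) (∣peak∣≤1+m j)
          y∈dual = vertices-in-dual⇒dual (lapVert G) y (λ i → subst (- 1ℚ ≤_) (sym (y-values i)) (peak≥-1 j i))
          k , on-facets = dual-vertex-on-facets (lapVert G) (λ k l → fromℤ (ws k l)) dual⇔hull y y∈dual
      in ws k , λ i i≢j → on-facets i (trans (y-values i) (peak-off i≢j))

    -- ⟨vᵢ , Z⟩ + 1 vanishes off j and sums to m+1, so (m+1)·λⱼ = ⟨∑ λᵢ vᵢ , Z⟩ + ht λ.
    tight-lattice-point⇒Λ-bound : ∀ j (z : Fin m → ℤ) →
      (∀ i → i ≢ j → dot (lapVert G i) (λ k → fromℤ (z k)) ≡ - 1ℚ) → ∀ l → InΛ G l → l j ≤ κ m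
    tight-lattice-point⇒Λ-bound j z tight l (0≤l<1 , ∑lv-integral , ht-integral) =
      ≤κ-if-integral m (proj₂ (0≤l<1 j))
        (subst IsInt (sym lⱼ*n≡⟨∑lv,Z⟩+ht) (isInt-+ ⟨∑lv,Z⟩-integral ht-integral))
      where
      open ≡-Reasoning
      Z : Point m
      Z k = fromℤ (z k)
      ∑lv : Point m
      ∑lv k = sumℚ (λ i → l i * lapVert G i k)
      e : Fin (suc m) → ℚ
      e i = dot (lapVert G i) Z + 1ℚ
      e-off : ∀ i → i ≢ j → e i ≡ 0ℚ
      e-off i i≢j = trans (cong (_+ 1ℚ) (tight i i≢j)) (ℚP.+-inverseˡ 1ℚ)
      eⱼ≡1+m : e j ≡ fromℤ (+ suc m)
      eⱼ≡1+m = begin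
        e j                                                   ≡⟨ sum-single e j e-off ⟨
        sumℚ e                                                ≡⟨ ∑-distrib-+ (λ i → dot (lapVert G i) Z) (λ _ → 1ℚ) ⟩
        sumℚ (λ i → dot (lapVert G i) Z) + sumℚ {suc m} (λ _ → 1ℚ)  ≡⟨ cong₂ _+_ (sum-dot-lapVert Z) (sum-const (suc m) 1ℚ) ⟩
        0ℚ + fromℤ (+ suc m) * 1ℚ                             ≡⟨ trans (ℚP.+-identityˡ _) (ℚP.*-identityʳ _) ⟩
        fromℤ (+ suc m)                                       ∎
      lⱼ*n≡⟨∑lv,Z⟩+ht : l j * fromℤ (+ suc m) ≡ dot ∑lv Z + sumℚ l
      lⱼ*n≡⟨∑lv,Z⟩+ht = begin
        l j * fromℤ (+ suc m)                              ≡⟨ cong (l j *_) eⱼ≡1+m ⟨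
        l j * e j                                          ≡⟨ sum-single (λ i → l i * e i) j
                                                                (λ i i≢j → trans (cong (l i *_) (e-off i i≢j)) (ℚP.*-zeroʳ (l i))) ⟨
        sumℚ (λ i → l i * e i)                             ≡⟨ sum-cong-≗ (λ i → trans (ℚP.*-distribˡ-+ (l i) _ 1ℚ)
                                                                (cong (_+_ (l i * dot (lapVert G i) Z)) (ℚP.*-identityʳ (l i)))) ⟩
        sumℚ (λ i → l i * dot (lapVert G i) Z + l i)       ≡⟨ ∑-distrib-+ (λ i → l i * dot (lapVert G i) Z) l ⟩
        sumℚ (λ i → l i * dot (lapVert G i) Z) + sumℚ l    ≡⟨ cong (_+ sumℚ l) (dot-combinationˡ l (lapVert G) Z) ⟨
        dot ∑lv Z + sumℚ l                                 ∎
      ⟨∑lv,Z⟩-integral : IsInt (dot ∑lv Z)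
      ⟨∑lv,Z⟩-integral = isInt-sum (λ k → ∑lv k * Z k) (λ k → isInt-* (∑lv-integral k) (z k , refl))

    Λ-bound : IsReflexive (lapVert G) → ∀ l → InΛ G l → ∀ j → l j ≤ κ m
    Λ-bound reflexive l l∈Λ j =
      let z , tight = reflexive⇒tight-lattice-point reflexive j in tight-lattice-point⇒Λ-bound j z tight l l∈Λ

    fΛ-preserves-Λ : IsReflexive (lapVert G) → ∀ l → InΛ G l → InΛ G (fΛ l)
    fΛ-preserves-Λ reflexive l l∈Λ@(0≤l<1 , ∑lv-integral , ht-integral) =
        (λ i → 0≤fl i , fl<1 i)
      , (λ k → subst IsInt (sym (∑flv≡-∑lv k)) (isInt-neg (∑lv-integral k)))
      , subst IsInt (sym (ht-fΛ l)) (isInt-+ (+ m , refl) (isInt-neg ht-integral))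
      where
      0≤fl : ∀ i → 0ℚ ≤ fΛ l i
      0≤fl i = subst (_≤ fΛ l i) (ℚP.+-inverseʳ (l i)) (ℚP.+-monoˡ-≤ (- l i) (Λ-bound reflexive l l∈Λ i))
      fl<1 : ∀ i → fΛ l i < 1ℚ
      fl<1 i = ℚP.≤-<-trans (subst (fΛ l i ≤_) (ℚP.+-identityʳ (κ m))
                               (ℚP.+-monoʳ-≤ (κ m) (ℚP.neg-antimono-≤ (proj₁ (0≤l<1 i)))))
                             (κ<1 m)
      ∑flv≡-∑lv : ∀ k → sumℚ (λ i → fΛ l i * lapVert G i k) ≡ - sumℚ (λ i → l i * lapVert G i k)
      ∑flv≡-∑lv k = begin
        sumℚ (λ i → (κ m + - l i) * v i)                        ≡⟨ sum-cong-≗ (λ i → solve 3 (λ q x y → (q :+ :- x) :* y := q :* y :+ :- (x :* y)) refl (κ m) (l i) (v i)) ⟩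
        sumℚ (λ i → κ m * v i + - (l i * v i))                  ≡⟨ ∑-distrib-+ (λ i → κ m * v i) (λ i → - (l i * v i)) ⟩
        sumℚ (λ i → κ m * v i) + sumℚ (λ i → - (l i * v i))     ≡⟨ cong₂ _+_ (sym (*-distribˡ-sum (κ m) v)) (sum-neg (λ i → l i * v i)) ⟩
        κ m * sumℚ v + - sumℚ (λ i → l i * v i)                 ≡⟨ cong (λ t → κ m * t + - sumℚ (λ i → l i * v i)) (lapVert-sum k) ⟩
        κ m * 0ℚ + - sumℚ (λ i → l i * v i)                     ≡⟨ solve 2 (λ q s → q :* con 0ℚ :+ :- s := :- s) refl (κ m) (sumℚ (λ i → l i * v i)) ⟩
        - sumℚ (λ i → l i * v i)                                ∎
        where
        open ≡-Reasoning
        v : Fin (suc m) → ℚ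
        v i = lapVert G i k


open import Defs
open import Data.Nat using (ℕ; suc; _≤_; _∸_)
open import Data.Integer using (ℤ; +_; _-_)
open import Data.Rational using (ℚ)
open import Data.Fin using (Fin)
open import Data.Product using (Σ; _×_; _,_)
open import Relation.Binary.PropositionalEquality using (_≡_; trans)
open import Function.Bundles using (_⇔_; Equivalence)
open LaplacianSimplex
  using (fΛ-preserves-Λ; fΛ-injective; fΛ-involutive; ht-fΛ-iff; ht-fΛ-level; ht-fΛ∘fΛ)

lemma3p31 : (m : ℕ) (G : SimpleGraph (suc m)) → Connected G → IsReflexive (lapVert G) →
  -- f is well defined: Λ → Λ
  (∀ l → InΛ G l → InΛ G (fΛ l))
  -- f is injective on Λ
  × (∀ l l′ → InΛ G l → InΛ G l′ → (∀ i → fΛ l i ≡ fΛ l′ i) → ∀ i → l i ≡ l′ i)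
  -- f is surjective onto Λ
  × (∀ μ → InΛ G μ → Σ (Fin (suc m) → ℚ) λ l → InΛ G l × (∀ i → fΛ l i ≡ μ i))
  -- ht(λ) = i  iff  ht(f λ) = n - 1 - i
  × (∀ l → InΛ G l → (i : ℤ) → (ht l ≡ fromℤ i) ⇔ (ht (fΛ l) ≡ fromℤ ((+ m) - i)))
  -- restriction to height-i level sets, 0 ≤ i ≤ n-1, is a bijection onto height n-1-i
  × (∀ (i : ℕ) → i ≤ m →
      (∀ l → InΛ G l → ht l ≡ fromℤ (+ i) →
        InΛ G (fΛ l) × (ht (fΛ l) ≡ fromℤ (+ (m ∸ i))))
      × (∀ l l′ → InΛ G l → InΛ G l′ → ht l ≡ fromℤ (+ i) → ht l′ ≡ fromℤ (+ i) →
          (∀ j → fΛ l j ≡ fΛ l′ j) → ∀ j → l j ≡ l′ j)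
      × (∀ μ → InΛ G μ → ht μ ≡ fromℤ (+ (m ∸ i)) →
          Σ (Fin (suc m) → ℚ) λ l → InΛ G l × (ht l ≡ fromℤ (+ i)) × (∀ j → fΛ l j ≡ μ j)))
lemma3p31 m G _ reflexive =
    f∈Λ
  , (λ l l′ _ _ → fΛ-injective l l′)
  , (λ μ μ∈Λ → fΛ μ , f∈Λ μ μ∈Λ , fΛ-involutive μ)
  , (λ l _ → ht-fΛ-iff l)
  , λ i i≤m →
      (λ l l∈Λ htl≡i → f∈Λ l l∈Λ , Equivalence.to (ht-fΛ-level l i≤m) htl≡i)
    , (λ l l′ _ _ _ _ → fΛ-injective l l′)
    , (λ μ μ∈Λ htμ≡m∸i →
          fΛ μ
        , f∈Λ μ μ∈Λ
        , Equivalence.from (ht-fΛ-level (fΛ μ) i≤m) (trans (ht-fΛ∘fΛ μ) htμ≡m∸i)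
        , fΛ-involutive μ)
  where
  f∈Λ : ∀ l → InΛ G l → InΛ G (fΛ l)
  f∈Λ = fΛ-preserves-Λ G reflexive
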